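{- For integers $t \ge 1$, let $N'(t)$ be the number of fault-free tilings of the $4 \times 2t$ rectangle by $L$ tetrominoes, and set $N'(0)=0$. Then \[ \sum_{t \ge 0} N'(t)\, z^t = \frac{2 z\,(1 + z)^2\,(1 - z - z^3)}{1 - 2 z - z^3}. \] Consequently $N'(t)$ grows like $\lambda'^t$, where $\lambda' = \frac{1}{3}\left(2 + \sqrt[3]{\tfrac{43}{2} - \tfrac{3\sqrt{177}}{2}} + \sqrt[3]{\tfrac{43}{2} + \tfrac{3\sqrt{177}}{2}}\right) = 2.2055694\ldots$ is the largest root of $\lambda'^3 - 2\lambda'^2 - 1 = 0$.
   Context: The $L$ tetromino is the polyomino with cells $(0,0),(0,1),(0,2),(1,0)$. A tiling of a region by a polyomino is a partition of its unit cells into copies of the polyomino, where copies may be translated, rotated and reflected. A $4 \times n$ rectangle has 4 rows and $n$ columns, occupying $[0,n]\times[0,4]$. A tiling of it is fault-free if there is no integer $k$ with $0<k<n$ such that every tile lies entirely in $x \le k$ or entirely in $x \ge k$. -}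

module Defs where

open import Data.Bool using (Bool; true; false; _∧_; _∨_; not; if_then_else_)
open import Data.Nat as ℕ using (ℕ; zero; suc; _+_; _∸_; _⊓_; _<ᵇ_; _≡ᵇ_)
open import Data.Fin using (Fin; toℕ)
open import Data.Integer as ℤ using (ℤ; +_; -[1+_])
open import Data.List using (List; []; _∷_; map; foldr; length; concatMap; upTo; allFin; _++_)
open import Data.Product using (_×_; _,_; proj₁; proj₂)

-- Cells are pairs (x , y) of natural numbers: the unit square [x,x+1]×[y,y+1].
-- The 4 × n rectangle [0,n]×[0,4] consists of the cells with x < n and y < 4.

all : {A : Set} → (A → Bool) → List A → Bool
all p = foldr (λ x b → p x ∧ b) true

any : {A : Set} → (A → Bool) → List A → Bool
any p = foldr (λ x b → p x ∨ b) false

boolFilter : {A : Set} → (A → Bool) → List A → List A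
boolFilter p = foldr (λ x r → if p x then x ∷ r else r) []

Cell : Set
Cell = ℕ × ℕ

Lcells : List Cell
Lcells = (0 , 0) ∷ (0 , 1) ∷ (0 , 2) ∷ (1 , 0) ∷ []

-- The 8 symmetries of the square, acting on the box [0,2]×[0,2]
-- (all L cells have coordinates ≤ 2).
sym : Fin 8 → Cell → Cell
sym o (x , y) with toℕ o
... | 0 = (x , y)
... | 1 = (2 ∸ x , y)
... | 2 = (x , 2 ∸ y)
... | 3 = (2 ∸ x , 2 ∸ y)
... | 4 = (y , x)
... | 5 = (2 ∸ y , x)
... | 6 = (y , 2 ∸ x)
... | _ = (2 ∸ y , 2 ∸ x)

normalize : List Cell → List Cell
normalize cs = map (λ { (x , y) → (x ∸ mx , y ∸ my) }) cs
  where
  mx = foldr (λ c m → proj₁ c ⊓ m) 10 cs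
  my = foldr (λ c m → proj₂ c ⊓ m) 10 cs

shape : Fin 8 → List Cell
shape o = normalize (map (sym o) Lcells)

-- A placed tile: an orientation together with the position (a , b) of the
-- lower-left corner of its bounding box.  (L has trivial symmetry group, so
-- distinct placements give distinct sets of cells.)
Placement : Set
Placement = Fin 8 × ℕ × ℕ

tileCells : Placement → List Cell
tileCells (o , a , b) = map (λ { (x , y) → (a + x , b + y) }) (shape o)

-- All placements whose bounding-box corner lies in the 4 × n rectangle
-- (every tile contained in the rectangle is among these).
placements : ℕ → List Placement
placements n =
  concatMap (λ o → concatMap (λ a → map (λ b → (o , a , b)) (upTo 4)) (upTo n)) (allFin 8)

subsets : {A : Set} → List A → List (List A)
subsets []       = [] ∷ []
subsets (x ∷ xs) = let r = subsets xs in map (x ∷_) r ++ r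

sameCell : Cell → Cell → Bool
sameCell (x , y) (x' , y') = (x ≡ᵇ x') ∧ (y ≡ᵇ y')

covers : Placement → Cell → Bool
covers p c = any (sameCell c) (tileCells p)

inRect : ℕ → Cell → Bool
inRect n (x , y) = (x <ᵇ n) ∧ (y <ᵇ 4)

rectCells : ℕ → List Cell
rectCells n = concatMap (λ x → map (λ y → (x , y)) (upTo 4)) (upTo n)

isTiling : ℕ → List Placement → Bool
isTiling n S =
  all (λ p → all (inRect n) (tileCells p)) S ∧
  all (λ c → length (boolFilter (λ p → covers p c) S) ≡ᵇ 1) (rectCells n)

-- Tile p crosses the vertical line x = k: it is neither entirely in x ≤ k
-- (all its cells have column < k) nor entirely in x ≥ k (all columns ≥ k).
crosses : ℕ → Placement → Bool
crosses k p = not (all (λ c → proj₁ c <ᵇ k) (tileCells p))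
            ∧ not (all (λ c → not (proj₁ c <ᵇ k)) (tileCells p))

isFaultFree : ℕ → List Placement → Bool
isFaultFree n S = all (λ k → any (crosses k) S) (boolFilter (λ k → 0 <ᵇ k) (upTo n))

numFaultFree : ℕ → ℕ
numFaultFree n =
  length (boolFilter (λ S → isTiling n S ∧ isFaultFree n S) (subsets (placements n)))

N' : ℕ → ℕ
N' zero    = 0
N' (suc t) = numFaultFree (2 ℕ.* suc t)

Series : Set
Series = ℕ → ℤ

_⋆_ : Series → Series → Series
(f ⋆ g) t = foldr (λ i s → f i ℤ.* g (t ∸ i) ℤ.+ s) (+ 0) (upTo (suc t))

-- Polynomials as coefficient lists (constant term first) and their series.
Poly : Set
Poly = List ℤ

coeff : Poly → Series
coeff []       _       = + 0
coeff (c ∷ cs) zero    = c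
coeff (c ∷ cs) (suc t) = coeff cs t

_*ₚ_ : Poly → Poly → Poly
[]       *ₚ q = []
(c ∷ cs) *ₚ q = addP (map (c ℤ.*_) q) (+ 0 ∷ (cs *ₚ q))
  where
  addP : Poly → Poly → Poly
  addP []       ys       = ys
  addP xs       []       = xs
  addP (x ∷ xs) (y ∷ ys) = (x ℤ.+ y) ∷ addP xs ys

numerator : Poly
numerator = (+ 0 ∷ + 2 ∷ []) *ₚ ((+ 1 ∷ + 1 ∷ []) *ₚ ((+ 1 ∷ + 1 ∷ []) *ₚ (+ 1 ∷ -[1+ 0 ] ∷ + 0 ∷ -[1+ 0 ] ∷ [])))

denominator : Poly
denominator = + 1 ∷ -[1+ 1 ] ∷ + 0 ∷ -[1+ 0 ] ∷ []

genN' : Series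
genN' t = + (N' t)

-- Tile the rectangle column by column.  Removing the tiles whose leftmost cells lie in the first
-- column leaves the problem of completing a narrower rectangle whose first two columns are
-- partially covered already, and whose first inner line may already be crossed; an L tile spans
-- at most three columns, so this state is finite data.  Counting the completions of every state
-- gives a transfer-matrix recursion, and only 23 states ever occur.  Evaluating it, the vectors of
-- counts by width satisfy v(k + 6) = 2 v(k + 4) + v(k) for k ≥ 7, hence
-- N'(t + 3) = 2 N'(t + 2) + N'(t) for t ≥ 4.  Together with N'(0), …, N'(6) = 0, 2, 6, 10, 18, 38, 84
-- this says that (1 - 2z - z³) Σ N'(t) zᵗ is the polynomial 2z(1 + z)²(1 - z - z³).
module Submission where

open import Defs hiding (sym)

open import Algebra.Bundles using (CommutativeMonoid)
open import Algebra.Core using (Op₂)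
import Algebra.Properties.CommutativeSemigroup as CommutativeSemigroupProperties
open import Algebra.Structures using (IsCommutativeMonoid)
open import Data.Bool using (Bool; true; false; _∧_; _∨_; not; if_then_else_)
import Data.Bool as Bool
open import Data.Bool.Properties
  using (∧-isCommutativeMonoid; ∨-isCommutativeMonoid; ∧-commutativeMonoid; ∧-assoc; ∨-assoc;
         ∧-identityʳ; ∨-identityʳ; ∧-zeroʳ; ∧-conicalˡ; ∧-conicalʳ)
open import Data.Fin as Fin using (Fin; toℕ; #_)
open import Data.Fin.Patterns using (0F; 1F; 2F; 3F; 4F; 5F; 6F; 7F)
open import Data.Fin.Properties using (any?; all?)
open import Data.List using (List; []; _∷_; map; foldr; length; concatMap; upTo; applyUpTo; allFin; _++_)
open import Data.List.Properties
  using (foldr-map; foldr-cong; foldr-fusion; map-∘; map-upTo; concatMap-cong; concatMap-map; map-concatMap)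
import Data.List.Properties as List
open import Data.List.Membership.Propositional using (_∈_)
open import Data.List.Membership.Propositional.Properties using (∈-upTo⁻; ∈-upTo⁺; ∈-map⁺; ∈-concat⁺′)
open import Data.List.Relation.Binary.Permutation.Propositional
  using (_↭_; ↭-refl; prep; swap; ↭⇒↭ₛ; module PermutationReasoning)
  renaming (refl to ↭-refl′; trans to ↭-trans′)
import Data.List.Relation.Binary.Permutation.Propositional.Properties as ↭
open import Data.List.Relation.Binary.Permutation.Setoid.Properties using (foldr-commMonoid)
open import Data.List.Relation.Unary.All using (All; []; _∷_)
open import Data.List.Relation.Unary.All.Properties using (concat⁺; map⁺; tabulate⁺; applyUpTo⁺₂)
open import Data.List.Relation.Unary.Any using (here; there)
open import Data.Nat using (ℕ; zero; suc; _+_; _*_; _∸_; _≤_; _<_; _<ᵇ_; _≡ᵇ_; _≤ᵇ_; s≤s; z≤n; _≤?_)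
import Data.Nat as ℕ
open import Data.Nat.Properties
  using (+-0-isCommutativeMonoid; +-commutativeSemigroup; +-assoc; +-identityˡ; +-identityʳ; *-zeroʳ; *-distribˡ-+;
         m∸n≤m; ≤-trans; ≰⇒>; m≤n⇒∃[o]m+o≡n)
open import Data.Product using (_×_; _,_; proj₁; proj₂; ∃-syntax)
open import Data.Vec using (Vec; []; _∷_; zipWith; replicate; tabulate; lookup)
open import Data.Vec.Properties
  using (zipWith-assoc; zipWith-identityˡ; zipWith-identityʳ; lookup-zipWith; lookup∘tabulate; lookup-replicate)
import Data.Vec.Properties as Vec
open import Function using (_∘_; id)
open import Relation.Binary.Definitions using (DecidableEquality)
open import Relation.Binary.PropositionalEquality
open import Relation.Nullary.Decidable using (Dec; yes; no; does; map′; _×-dec_; toWitness)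

module _ {A M : Set} {_∙_ : Op₂ M} {ε : M} (monoid : IsCommutativeMonoid _≡_ _∙_ ε) (f : A → M) where

  open IsCommutativeMonoid monoid using (assoc; identityˡ)

  foldMap-++ : ∀ xs ys → foldr (λ x r → f x ∙ r) ε (xs ++ ys)
                       ≡ foldr (λ x r → f x ∙ r) ε xs ∙ foldr (λ x r → f x ∙ r) ε ys
  foldMap-++ []       ys = sym (identityˡ _)
  foldMap-++ (x ∷ xs) ys = trans (cong (f x ∙_) (foldMap-++ xs ys)) (sym (assoc (f x) _ _))

  foldMap-↭ : ∀ {xs ys} → xs ↭ ys → foldr (λ x r → f x ∙ r) ε xs ≡ foldr (λ x r → f x ∙ r) ε ys
  foldMap-↭ {xs} {ys} xs↭ys = begin
    foldr (λ x r → f x ∙ r) ε xs ≡⟨ foldr-map _∙_ f ε xs ⟨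
    foldr _∙_ ε (map f xs)        ≡⟨ foldr-commMonoid (setoid M) monoid (↭⇒↭ₛ (↭.map⁺ f xs↭ys)) ⟩
    foldr _∙_ ε (map f ys)        ≡⟨ foldr-map _∙_ f ε ys ⟩
    foldr (λ x r → f x ∙ r) ε ys  ∎
    where open ≡-Reasoning

indicator : Bool → ℕ
indicator true  = 1
indicator false = 0

sumOver : {A : Set} → (A → ℕ) → List A → ℕ
sumOver f = foldr (λ x r → f x + r) 0

module _ {A : Set} where

  all-++ : (p : A → Bool) (xs ys : List A) → all p (xs ++ ys) ≡ all p xs ∧ all p ys
  all-++ = foldMap-++ ∧-isCommutativeMonoid

  any-++ : (p : A → Bool) (xs ys : List A) → any p (xs ++ ys) ≡ any p xs ∨ any p ys
  any-++ = foldMap-++ ∨-isCommutativeMonoid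

  sumOver-++ : (f : A → ℕ) (xs ys : List A) → sumOver f (xs ++ ys) ≡ sumOver f xs + sumOver f ys
  sumOver-++ = foldMap-++ +-0-isCommutativeMonoid

  all-↭ : (p : A → Bool) {xs ys : List A} → xs ↭ ys → all p xs ≡ all p ys
  all-↭ = foldMap-↭ ∧-isCommutativeMonoid

  any-↭ : (p : A → Bool) {xs ys : List A} → xs ↭ ys → any p xs ≡ any p ys
  any-↭ = foldMap-↭ ∨-isCommutativeMonoid

  sumOver-↭ : (f : A → ℕ) {xs ys : List A} → xs ↭ ys → sumOver f xs ≡ sumOver f ys
  sumOver-↭ = foldMap-↭ +-0-isCommutativeMonoid

  all-cong : {p q : A → Bool} → (∀ x → p x ≡ q x) → ∀ xs → all p xs ≡ all q xs
  all-cong p≗q = foldr-cong (λ x b → cong (_∧ b) (p≗q x)) refl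

  any-cong : {p q : A → Bool} → (∀ x → p x ≡ q x) → ∀ xs → any p xs ≡ any q xs
  any-cong p≗q = foldr-cong (λ x b → cong (_∨ b) (p≗q x)) refl

  sumOver-cong : {f g : A → ℕ} → (∀ x → f x ≡ g x) → ∀ xs → sumOver f xs ≡ sumOver g xs
  sumOver-cong f≗g = foldr-cong (λ x n → cong (_+ n) (f≗g x)) refl

  all-cong-∈ : {p q : A → Bool} {xs : List A} → (∀ {x} → x ∈ xs → p x ≡ q x) → all p xs ≡ all q xs
  all-cong-∈ {xs = []}     p≗q = refl
  all-cong-∈ {xs = x ∷ xs} p≗q = cong₂ _∧_ (p≗q (here refl)) (all-cong-∈ (p≗q ∘ there))

  all-∈-false : (p : A → Bool) {x : A} {xs : List A} → x ∈ xs → p x ≡ false → all p xs ≡ false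
  all-∈-false p {xs = y ∷ ys} (here refl) px≡false = cong (_∧ all p ys) px≡false
  all-∈-false p {xs = y ∷ ys} (there x∈ys) px≡false =
    trans (cong (p y ∧_) (all-∈-false p x∈ys px≡false)) (∧-zeroʳ (p y))

  any-witness : (p : A → Bool) (xs : List A) → any p xs ≡ true → ∃[ x ] x ∈ xs × p x ≡ true
  any-witness p (x ∷ xs) anyp with p x in px
  ... | true  = x , here refl , px
  ... | false with y , y∈xs , py ← any-witness p xs anyp = y , there y∈xs , py

  all-true : {p : A → Bool} → (∀ x → p x ≡ true) → ∀ xs → all p xs ≡ true
  all-true p≡true []       = refl
  all-true p≡true (x ∷ xs) = cong₂ _∧_ (p≡true x) (all-true p≡true xs)

  any-false : {p : A → Bool} → (∀ x → p x ≡ false) → ∀ xs → any p xs ≡ false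
  any-false p≡false []       = refl
  any-false p≡false (x ∷ xs) = cong₂ _∨_ (p≡false x) (any-false p≡false xs)

  sumOver-const-zero : {f : A → ℕ} → (∀ x → f x ≡ 0) → ∀ xs → sumOver f xs ≡ 0
  sumOver-const-zero f≡0 []       = refl
  sumOver-const-zero f≡0 (x ∷ xs) = cong₂ _+_ (f≡0 x) (sumOver-const-zero f≡0 xs)

  length-boolFilter : (p : A → Bool) (xs : List A) → length (boolFilter p xs) ≡ sumOver (indicator ∘ p) xs
  length-boolFilter p []       = refl
  length-boolFilter p (x ∷ xs) with p x
  ... | true  = cong suc (length-boolFilter p xs)
  ... | false = length-boolFilter p xs

sumOver-linear : {A : Set} (c : ℕ) (f g : A → ℕ) (xs : List A) →
                 sumOver (λ x → c * f x + g x) xs ≡ c * sumOver f xs + sumOver g xs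
sumOver-linear c f g []       = cong (_+ 0) (sym (*-zeroʳ c))
sumOver-linear c f g (x ∷ xs) = begin
  (c * f x + g x) + sumOver (λ x → c * f x + g x) xs   ≡⟨ cong ((c * f x + g x) +_) (sumOver-linear c f g xs) ⟩
  (c * f x + g x) + (c * sumOver f xs + sumOver g xs)  ≡⟨ interchange (c * f x) (g x) (c * sumOver f xs) (sumOver g xs) ⟩
  (c * f x + c * sumOver f xs) + (g x + sumOver g xs)  ≡⟨ cong (_+ (g x + sumOver g xs)) (*-distribˡ-+ c (f x) (sumOver f xs)) ⟨
  c * (f x + sumOver f xs) + (g x + sumOver g xs)      ∎
  where
  open ≡-Reasoning
  open CommutativeSemigroupProperties +-commutativeSemigroup using (interchange)

module _ {A B : Set} (f : A → B) where

  all-map : (p : B → Bool) (xs : List A) → all p (map f xs) ≡ all (p ∘ f) xs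
  all-map p = foldr-map _ f true

  any-map : (p : B → Bool) (xs : List A) → any p (map f xs) ≡ any (p ∘ f) xs
  any-map p = foldr-map _ f false

  sumOver-map : (g : B → ℕ) (xs : List A) → sumOver g (map f xs) ≡ sumOver (g ∘ f) xs
  sumOver-map g = foldr-map _ f 0

∧-reassociate : ∀ a b c d e f → ((a ∧ b) ∧ (c ∧ d)) ∧ (e ∧ f) ≡ (a ∧ (c ∧ e)) ∧ ((b ∧ d) ∧ f)
∧-reassociate a b c d e f = begin
  ((a ∧ b) ∧ (c ∧ d)) ∧ (e ∧ f)  ≡⟨ cong (_∧ (e ∧ f)) (interchange a b c d) ⟩
  ((a ∧ c) ∧ (b ∧ d)) ∧ (e ∧ f)  ≡⟨ interchange (a ∧ c) (b ∧ d) e f ⟩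
  ((a ∧ c) ∧ e) ∧ ((b ∧ d) ∧ f)  ≡⟨ cong (_∧ ((b ∧ d) ∧ f)) (∧-assoc a c e) ⟩
  (a ∧ (c ∧ e)) ∧ ((b ∧ d) ∧ f)  ∎
  where
  open ≡-Reasoning
  open CommutativeSemigroupProperties (CommutativeMonoid.commutativeSemigroup ∧-commutativeMonoid) using (interchange)

all-concatMap : {A B : Set} (p : B → Bool) (f : A → List B) (xs : List A) →
                all p (concatMap f xs) ≡ all (all p ∘ f) xs
all-concatMap p f []       = refl
all-concatMap p f (x ∷ xs) = trans (all-++ p (f x) (concatMap f xs)) (cong (all p (f x) ∧_) (all-concatMap p f xs))

upTo-suc : ∀ n → upTo (suc n) ≡ 0 ∷ map suc (upTo n)
upTo-suc n = cong (0 ∷_) (sym (map-upTo suc n))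

subsetSum : {A : Set} → (List A → ℕ) → List A → ℕ
subsetSum f xs = sumOver f (subsets xs)

module _ {A : Set} where

  subsetSum-∷ : (f : List A → ℕ) (x : A) (xs : List A) →
                subsetSum f (x ∷ xs) ≡ subsetSum (f ∘ (x ∷_)) xs + subsetSum f xs
  subsetSum-∷ f x xs = trans (sumOver-++ f (map (x ∷_) (subsets xs)) (subsets xs))
                             (cong (_+ subsetSum f xs) (sumOver-map (x ∷_) f (subsets xs)))

  subsetSum-cong : {f g : List A → ℕ} → (∀ S → f S ≡ g S) → ∀ xs → subsetSum f xs ≡ subsetSum g xs
  subsetSum-cong f≗g xs = sumOver-cong f≗g (subsets xs)

  subsetSum-zero : {f : List A → ℕ} → (∀ S → f S ≡ 0) → ∀ xs → subsetSum f xs ≡ 0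
  subsetSum-zero f≡0 xs = sumOver-const-zero f≡0 (subsets xs)

  subsetSum-cong-All : {P : A → Set} {f g : List A → ℕ} {xs : List A} → All P xs →
                       (∀ S → All P S → f S ≡ g S) → subsetSum f xs ≡ subsetSum g xs
  subsetSum-cong-All {f = f} {g} {[]}     []         f≗g = cong (_+ 0) (f≗g [] [])
  subsetSum-cong-All {f = f} {g} {x ∷ xs} (px ∷ pxs) f≗g = begin
    subsetSum f (x ∷ xs)                          ≡⟨ subsetSum-∷ f x xs ⟩
    subsetSum (f ∘ (x ∷_)) xs + subsetSum f xs    ≡⟨ cong₂ _+_ (subsetSum-cong-All pxs (λ S pS → f≗g (x ∷ S) (px ∷ pS)))
                                                               (subsetSum-cong-All pxs f≗g) ⟩
    subsetSum (g ∘ (x ∷_)) xs + subsetSum g xs    ≡⟨ subsetSum-∷ g x xs ⟨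
    subsetSum g (x ∷ xs)                          ∎
    where open ≡-Reasoning

  subsetSum-++ : (f : List A → ℕ) (xs ys : List A) →
                 subsetSum f (xs ++ ys) ≡ subsetSum (λ S → subsetSum (f ∘ (S ++_)) ys) xs
  subsetSum-++ f []       ys = sym (+-identityʳ _)
  subsetSum-++ f (x ∷ xs) ys = begin
    subsetSum f (x ∷ xs ++ ys)                               ≡⟨ subsetSum-∷ f x (xs ++ ys) ⟩
    subsetSum (f ∘ (x ∷_)) (xs ++ ys) + subsetSum f (xs ++ ys)
                                                             ≡⟨ cong₂ _+_ (subsetSum-++ (f ∘ (x ∷_)) xs ys) (subsetSum-++ f xs ys) ⟩
    subsetSum (λ S → subsetSum (f ∘ ((x ∷ S) ++_)) ys) xs + subsetSum (λ S → subsetSum (f ∘ (S ++_)) ys) xs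
                                                             ≡⟨ subsetSum-∷ (λ S → subsetSum (f ∘ (S ++_)) ys) x xs ⟨
    subsetSum (λ S → subsetSum (f ∘ (S ++_)) ys) (x ∷ xs)    ∎
    where open ≡-Reasoning

  subsetSum-↭ : (f : List A → ℕ) → (∀ {S S′} → S ↭ S′ → f S ≡ f S′) →
                ∀ {xs ys} → xs ↭ ys → subsetSum f xs ≡ subsetSum f ys
  subsetSum-↭ f resp ↭-refl′ = refl
  subsetSum-↭ f resp (prep {xs} {ys} x xs↭ys) =
    trans (subsetSum-∷ f x xs)
      (trans (cong₂ _+_ (subsetSum-↭ (f ∘ (x ∷_)) (resp ∘ prep x) xs↭ys) (subsetSum-↭ f resp xs↭ys))
        (sym (subsetSum-∷ f x ys)))
  subsetSum-↭ f resp (swap {xs} {ys} x y xs↭ys) = begin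
    subsetSum f (x ∷ y ∷ xs)  ≡⟨ expand x y xs ⟩
    (Σxy xs + Σx xs) + (Σy xs + Σ xs)
      ≡⟨ cong₂ _+_ (cong₂ _+_ Σxy≡Σyx (subsetSum-↭ _ (resp ∘ prep x) xs↭ys))
                   (cong₂ _+_ (subsetSum-↭ _ (resp ∘ prep y) xs↭ys) (subsetSum-↭ f resp xs↭ys)) ⟩
    (Σyx ys + Σx ys) + (Σy ys + Σ ys)  ≡⟨ interchange (Σyx ys) (Σx ys) (Σy ys) (Σ ys) ⟩
    (Σyx ys + Σy ys) + (Σx ys + Σ ys)  ≡⟨ expand y x ys ⟨
    subsetSum f (y ∷ x ∷ ys)           ∎
    where
    open ≡-Reasoning
    open CommutativeSemigroupProperties +-commutativeSemigroup using (interchange)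
    Σ Σx Σy Σxy Σyx : List A → ℕ
    Σ   = subsetSum f
    Σx  = subsetSum (f ∘ (x ∷_))
    Σy  = subsetSum (f ∘ (y ∷_))
    Σxy = subsetSum (λ S → f (x ∷ y ∷ S))
    Σyx = subsetSum (λ S → f (y ∷ x ∷ S))
    expand : ∀ u v zs → subsetSum f (u ∷ v ∷ zs)
                      ≡ (subsetSum (λ S → f (u ∷ v ∷ S)) zs + subsetSum (f ∘ (u ∷_)) zs)
                        + (subsetSum (f ∘ (v ∷_)) zs + subsetSum f zs)
    expand u v zs =
      trans (subsetSum-∷ f u (v ∷ zs)) (cong₂ _+_ (subsetSum-∷ (f ∘ (u ∷_)) v zs) (subsetSum-∷ f v zs))
    Σxy≡Σyx : Σxy xs ≡ Σyx ys
    Σxy≡Σyx = trans (subsetSum-cong (λ S → resp (swap x y ↭-refl′)) xs)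
                    (subsetSum-↭ _ (resp ∘ prep y ∘ prep x) xs↭ys)
  subsetSum-↭ f resp (↭-trans′ xs↭ys ys↭zs) = trans (subsetSum-↭ f resp xs↭ys) (subsetSum-↭ f resp ys↭zs)

subsetSum-map : {A B : Set} (f : List B → ℕ) (g : A → B) (xs : List A) →
                subsetSum f (map g xs) ≡ subsetSum (f ∘ map g) xs
subsetSum-map f g []       = refl
subsetSum-map f g (x ∷ xs) = begin
  subsetSum f (g x ∷ map g xs)
    ≡⟨ subsetSum-∷ f (g x) (map g xs) ⟩
  subsetSum (f ∘ (g x ∷_)) (map g xs) + subsetSum f (map g xs)
    ≡⟨ cong₂ _+_ (subsetSum-map (f ∘ (g x ∷_)) g xs) (subsetSum-map f g xs) ⟩
  subsetSum (f ∘ map g ∘ (x ∷_)) xs + subsetSum (f ∘ map g) xs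
    ≡⟨ subsetSum-∷ (f ∘ map g) x xs ⟨
  subsetSum (f ∘ map g) (x ∷ xs) ∎
  where open ≡-Reasoning

shiftCell : Cell → Cell
shiftCell (x , y) = (suc x , y)

shift : Placement → Placement
shift (o , a , b) = (o , suc a , b)

tileCells-shift : ∀ p → tileCells (shift p) ≡ map shiftCell (tileCells p)
tileCells-shift (o , a , b) = map-∘ {g = shiftCell} {f = λ c → (a + proj₁ c , b + proj₂ c)} (shape o)

all-tileCells-shift : (q : Cell → Bool) (p : Placement) → all q (tileCells (shift p)) ≡ all (q ∘ shiftCell) (tileCells p)
all-tileCells-shift q p = trans (cong (all q) (tileCells-shift p)) (all-map shiftCell q (tileCells p))

any-tileCells-shift : (q : Cell → Bool) (p : Placement) → any q (tileCells (shift p)) ≡ any (q ∘ shiftCell) (tileCells p)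
any-tileCells-shift q p = trans (cong (any q) (tileCells-shift p)) (any-map shiftCell q (tileCells p))

covers-shift : ∀ p c → covers (shift p) (shiftCell c) ≡ covers p c
covers-shift p c = any-tileCells-shift (sameCell (shiftCell c)) p

covers-shift-column0 : ∀ p y → covers (shift p) (0 , y) ≡ false
covers-shift-column0 p y = trans (any-tileCells-shift (sameCell (0 , y)) p) (any-false (λ _ → refl) (tileCells p))

crosses-shift : ∀ k p → crosses (suc k) (shift p) ≡ crosses k p
crosses-shift k p = cong₂ (λ u v → not u ∧ not v)
  (all-tileCells-shift (λ c → proj₁ c <ᵇ suc k) p) (all-tileCells-shift (λ c → not (proj₁ c <ᵇ suc k)) p)

crosses-zero : ∀ p → crosses 0 p ≡ false
crosses-zero p = trans (cong (λ b → not (all (λ c → proj₁ c <ᵇ 0) (tileCells p)) ∧ not b)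
                              (all-true {p = λ c → not (proj₁ c <ᵇ 0)} (λ _ → refl) (tileCells p)))
                       (∧-zeroʳ (not (all (λ c → proj₁ c <ᵇ 0) (tileCells p))))

coverCount : List Placement → Cell → ℕ
coverCount S c = sumOver (λ p → indicator (covers p c)) S

coverCount-shift : ∀ T c → coverCount (map shift T) (shiftCell c) ≡ coverCount T c
coverCount-shift T c = trans (sumOver-map shift _ T) (sumOver-cong (λ p → cong indicator (covers-shift p c)) T)

coverCount-shift-column0 : ∀ T y → coverCount (map shift T) (0 , y) ≡ 0
coverCount-shift-column0 T y =
  trans (sumOver-map shift (λ p → indicator (covers p (0 , y))) T)
        (sumOver-const-zero (λ p → cong indicator (covers-shift-column0 p y)) T)

any-crosses-shift : ∀ k T → any (crosses (suc k)) (map shift T) ≡ any (crosses k) T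
any-crosses-shift k T = trans (any-map shift _ T) (any-cong (crosses-shift k) T)

any-crosses-zero : ∀ T → any (crosses 0) T ≡ false
any-crosses-zero T = any-false crosses-zero T

all-inside-shift : ∀ n T → all (λ p → all (inRect (suc n)) (tileCells p)) (map shift T)
                         ≡ all (λ p → all (inRect n) (tileCells p)) T
all-inside-shift n T = trans (all-map shift _ T) (all-cong (all-tileCells-shift (inRect (suc n))) T)

placementsAt : Fin 8 → ℕ → List Placement
placementsAt o a = map (λ b → (o , a , b)) (upTo 4)

firstColumnPlacements : List Placement
firstColumnPlacements = concatMap (λ o → placementsAt o 0) (allFin 8)

WithinThreeColumns : Placement → Set
WithinThreeColumns p = (∀ x y → covers p (3 + x , y) ≡ false) × (∀ k → crosses (3 + k) p ≡ false)

firstColumnPlacements-within : All WithinThreeColumns firstColumnPlacements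
firstColumnPlacements-within =
  concat⁺ (map⁺ (tabulate⁺ {f = id} λ o → map⁺ {f = λ b → (o , 0 , b)} (applyUpTo⁺₂ id 4 (within o))))
  where
  within : ∀ o b → WithinThreeColumns (o , 0 , b)
  within 0F _ = (λ _ _ → refl) , (λ _ → refl)
  within 1F _ = (λ _ _ → refl) , (λ _ → refl)
  within 2F _ = (λ _ _ → refl) , (λ _ → refl)
  within 3F _ = (λ _ _ → refl) , (λ _ → refl)
  within 4F _ = (λ _ _ → refl) , (λ _ → refl)
  within 5F _ = (λ _ _ → refl) , (λ _ → refl)
  within 6F _ = (λ _ _ → refl) , (λ _ → refl)
  within 7F _ = (λ _ _ → refl) , (λ _ → refl)

concatMap-++-↭ : {A B : Set} (f g : A → List B) (xs : List A) →
                 concatMap (λ x → f x ++ g x) xs ↭ concatMap f xs ++ concatMap g xs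
concatMap-++-↭ f g []       = ↭-refl
concatMap-++-↭ f g (x ∷ xs) = begin
  (f x ++ g x) ++ concatMap (λ x → f x ++ g x) xs  ≡⟨ List.++-assoc (f x) (g x) _ ⟩
  f x ++ g x ++ concatMap (λ x → f x ++ g x) xs    ↭⟨ ↭.++⁺ˡ (f x) (↭.++⁺ˡ (g x) (concatMap-++-↭ f g xs)) ⟩
  f x ++ g x ++ concatMap f xs ++ concatMap g xs   ↭⟨ ↭.++⁺ˡ (f x) (↭.shifts (g x) (concatMap f xs)) ⟩
  f x ++ concatMap f xs ++ g x ++ concatMap g xs   ≡⟨ List.++-assoc (f x) (concatMap f xs) _ ⟨
  (f x ++ concatMap f xs) ++ g x ++ concatMap g xs ∎
  where open PermutationReasoning

placementsAt-shift : ∀ o a → placementsAt o (suc a) ≡ map shift (placementsAt o a)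
placementsAt-shift o a = map-∘ {g = shift} {f = λ b → (o , a , b)} (upTo 4)

concatMap-placementsAt-suc : ∀ o n → concatMap (placementsAt o) (upTo (suc n))
                                   ≡ placementsAt o 0 ++ map shift (concatMap (placementsAt o) (upTo n))
concatMap-placementsAt-suc o n = begin
  concatMap (placementsAt o) (upTo (suc n))                          ≡⟨ cong (concatMap (placementsAt o)) (upTo-suc n) ⟩
  placementsAt o 0 ++ concatMap (placementsAt o) (map suc (upTo n))  ≡⟨ cong (placementsAt o 0 ++_) shifted ⟩
  placementsAt o 0 ++ map shift (concatMap (placementsAt o) (upTo n)) ∎
  where
  open ≡-Reasoning
  shifted : concatMap (placementsAt o) (map suc (upTo n)) ≡ map shift (concatMap (placementsAt o) (upTo n))
  shifted = begin
    concatMap (placementsAt o) (map suc (upTo n))     ≡⟨ concatMap-map (placementsAt o) suc (upTo n) ⟩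
    concatMap (placementsAt o ∘ suc) (upTo n)         ≡⟨ concatMap-cong (placementsAt-shift o) (upTo n) ⟩
    concatMap (map shift ∘ placementsAt o) (upTo n)   ≡⟨ map-concatMap shift (placementsAt o) (upTo n) ⟨
    map shift (concatMap (placementsAt o) (upTo n))   ∎

placements-suc-↭ : ∀ n → placements (suc n) ↭ firstColumnPlacements ++ map shift (placements n)
placements-suc-↭ n = begin
  placements (suc n)
    ≡⟨ concatMap-cong (λ o → concatMap-placementsAt-suc o n) (allFin 8) ⟩
  concatMap (λ o → placementsAt o 0 ++ map shift (row o)) (allFin 8)
    ↭⟨ concatMap-++-↭ (λ o → placementsAt o 0) (map shift ∘ row) (allFin 8) ⟩
  firstColumnPlacements ++ concatMap (map shift ∘ row) (allFin 8)
    ≡⟨ cong (firstColumnPlacements ++_) (map-concatMap shift row (allFin 8)) ⟨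
  firstColumnPlacements ++ map shift (placements n) ∎
  where
  open PermutationReasoning
  row : Fin 8 → List Placement
  row o = concatMap (placementsAt o) (upTo n)

at : {k : ℕ} → Vec ℕ k → ℕ → ℕ
at []      _       = 0
at (a ∷ _) zero    = a
at (_ ∷ u) (suc y) = at u y

at-zipWith-+ : ∀ {k} (u w : Vec ℕ k) y → at (zipWith _+_ u w) y ≡ at u y + at w y
at-zipWith-+ []      []      y       = refl
at-zipWith-+ (a ∷ u) (b ∷ w) zero    = refl
at-zipWith-+ (a ∷ u) (b ∷ w) (suc y) = at-zipWith-+ u w y

at-replicate-zero : ∀ k y → at (replicate k 0) y ≡ 0
at-replicate-zero zero    y       = refl
at-replicate-zero (suc k) zero    = refl
at-replicate-zero (suc k) (suc y) = at-replicate-zero k y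

at-tabulate : ∀ {k} (g : ℕ → ℕ) {y} → y < k → at (tabulate {n = k} (g ∘ toℕ)) y ≡ g y
at-tabulate {suc k} g {zero}  _         = refl
at-tabulate {suc k} g {suc y} (s≤s y<k) = at-tabulate (g ∘ suc) y<k

Column : Set
Column = Vec ℕ 4

-- A state records, for the first two columns of the rectangle still to be tiled, how often each
-- cell is already covered by tiles placed further left, and whether the line x = 1 is already
-- crossed by such a tile.
record State : Set where
  constructor state
  field
    first second : Column
    crossed      : Bool
open State

emptyState : State
emptyState = state (replicate 4 0) (replicate 4 0) false

occupancy : State → Cell → ℕ
occupancy s (zero , y)          = at (first s) y
occupancy s (suc zero , y)      = at (second s) y
occupancy s (suc (suc _) , _)   = 0

occupancy-emptyState : ∀ c → occupancy emptyState c ≡ 0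
occupancy-emptyState (zero , y)        = at-replicate-zero 4 y
occupancy-emptyState (suc zero , y)    = at-replicate-zero 4 y
occupancy-emptyState (suc (suc _) , _) = refl

innerLines : ℕ → List ℕ
innerLines n = boolFilter (λ k → 0 <ᵇ k) (upTo n)

innerLines-suc : ∀ n → innerLines (suc n) ≡ map suc (upTo n)
innerLines-suc n = trans (cong (boolFilter (λ k → 0 <ᵇ k)) (upTo-suc n)) (positive (upTo n))
  where
  positive : ∀ ks → boolFilter (λ k → 0 <ᵇ k) (map suc ks) ≡ map suc ks
  positive []       = refl
  positive (k ∷ ks) = cong (suc k ∷_) (positive ks)

Completes : ℕ → State → List Placement → Bool
Completes n s S =
  (all (λ p → all (inRect n) (tileCells p)) S ∧ all (λ c → (occupancy s c + coverCount S c) ≡ᵇ 1) (rectCells n))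
  ∧ all (λ k → (crossed s ∧ (k ≡ᵇ 1)) ∨ any (crosses k) S) (innerLines n)

-- Opaque, so that the type checker never attempts to evaluate this exponential count.
opaque
  completions : ℕ → State → ℕ
  completions n s = subsetSum (indicator ∘ Completes n s) (placements n)

Completes-↭ : ∀ n s {S S′} → S ↭ S′ → Completes n s S ≡ Completes n s S′
Completes-↭ n s S↭S′ =
  cong₂ _∧_ (cong₂ _∧_ (all-↭ _ S↭S′)
                       (all-cong (λ c → cong (λ m → (occupancy s c + m) ≡ᵇ 1) (sumOver-↭ _ S↭S′)) (rectCells n)))
            (all-cong (λ k → cong ((crossed s ∧ (k ≡ᵇ 1)) ∨_) (any-↭ (crosses k) S↭S′)) (innerLines n))

opaque
  unfolding completions

  completions-zero : ∀ s → completions 0 s ≡ 1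
  completions-zero s = refl

  numFaultFree-completions : ∀ n → numFaultFree n ≡ completions n emptyState
  numFaultFree-completions n =
    trans (length-boolFilter _ (subsets (placements n)))
          (subsetSum-cong (λ S → cong indicator (tiling-Completes S)) (placements n))
    where
    tiling-Completes : ∀ S → (isTiling n S ∧ isFaultFree n S) ≡ Completes n emptyState S
    tiling-Completes S =
      cong (λ b → (all (λ p → all (inRect n) (tileCells p)) S ∧ b) ∧ isFaultFree n S)
           (all-cong (λ c → cong (_≡ᵇ 1) (trans (length-boolFilter (λ p → covers p c) S)
                                                (cong (_+ coverCount S c) (sym (occupancy-emptyState c)))))
                     (rectCells n))

-- Removing the first column

-- The contribution of a set of tiles anchored in the first column: how often they cover each cell
-- of the first three columns (they reach no further), whether they all fit in the rectangle, and
-- whether they cross the lines x = 1 and x = 2.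
record Summary : Set where
  constructor summary
  field
    columns  : Vec Column 3
    fits     : Bool
    crosses₁ : Bool
    crosses₂ : Bool
open Summary

column : Summary → Fin 3 → Column
column a = lookup (columns a)

_⊕_ : Summary → Summary → Summary
a ⊕ b = summary (zipWith (zipWith _+_) (columns a) (columns b))
                (fits a ∧ fits b) (crosses₁ a ∨ crosses₁ b) (crosses₂ a ∨ crosses₂ b)

emptySummary : Summary
emptySummary = summary (replicate 3 (replicate 4 0)) true false false

summary-cong : ∀ {k k′ f f′ c c′ d d′} → k ≡ k′ → f ≡ f′ → c ≡ c′ → d ≡ d′ →
               summary k f c d ≡ summary k′ f′ c′ d′
summary-cong refl refl refl refl = refl

⊕-assoc : ∀ a b c → (a ⊕ b) ⊕ c ≡ a ⊕ (b ⊕ c)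
⊕-assoc (summary k f c d) (summary k′ f′ c′ d′) (summary k″ f″ c″ d″) =
  summary-cong (zipWith-assoc (zipWith-assoc +-assoc) k k′ k″)
               (∧-assoc f f′ f″) (∨-assoc c c′ c″) (∨-assoc d d′ d″)

⊕-identityˡ : ∀ a → emptySummary ⊕ a ≡ a
⊕-identityˡ (summary k f c d) = summary-cong (zipWith-identityˡ (zipWith-identityˡ +-identityˡ) k) refl refl refl

⊕-identityʳ : ∀ a → a ⊕ emptySummary ≡ a
⊕-identityʳ (summary k f c d) =
  summary-cong (zipWith-identityʳ (zipWith-identityʳ +-identityʳ) k) (∧-identityʳ f) (∨-identityʳ c) (∨-identityʳ d)

summarize : ℕ → Placement → Summary
summarize n p = summary (tabulate λ x → tabulate λ y → indicator (covers p (toℕ x , toℕ y)))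
                        (all (inRect (suc n)) (tileCells p)) (crosses 1 p) (crosses 2 p)

summaryOf : ℕ → List Placement → Summary
summaryOf n = foldr (λ p a → summarize n p ⊕ a) emptySummary

coverCount-summaryOf : ∀ n S (x : Fin 3) {y} → y < 4 → coverCount S (toℕ x , y) ≡ at (column (summaryOf n S) x) y
coverCount-summaryOf n []      x {y} _   =
  sym (trans (cong (λ u → at u y) (lookup-replicate x (replicate 4 0))) (at-replicate-zero 4 y))
coverCount-summaryOf n (p ∷ S) x {y} y<4 = begin
  indicator (covers p (toℕ x , y)) + coverCount S (toℕ x , y)
    ≡⟨ cong₂ _+_ (sym (trans (cong (λ u → at u y) (lookup∘tabulate cellsOf x))
                             (at-tabulate (λ y → indicator (covers p (toℕ x , y))) y<4)))
                 (coverCount-summaryOf n S x y<4) ⟩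
  at (column (summarize n p) x) y + at (column (summaryOf n S) x) y
    ≡⟨ at-zipWith-+ (column (summarize n p) x) _ y ⟨
  at (zipWith _+_ (column (summarize n p) x) (column (summaryOf n S) x)) y
    ≡⟨ cong (λ u → at u y) (lookup-zipWith (zipWith _+_) x (columns (summarize n p)) (columns (summaryOf n S))) ⟨
  at (column (summaryOf n (p ∷ S)) x) y ∎
  where
  open ≡-Reasoning
  cellsOf : Fin 3 → Column
  cellsOf x = tabulate λ y → indicator (covers p (toℕ x , toℕ y))

fits-summaryOf : ∀ n S → all (λ p → all (inRect (suc n)) (tileCells p)) S ≡ fits (summaryOf n S)
fits-summaryOf n S = sym (foldr-fusion fits emptySummary (λ _ _ → refl) S)

crosses₁-summaryOf : ∀ n S → any (crosses 1) S ≡ crosses₁ (summaryOf n S)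
crosses₁-summaryOf n S = sym (foldr-fusion crosses₁ emptySummary (λ _ _ → refl) S)

crosses₂-summaryOf : ∀ n S → any (crosses 2) S ≡ crosses₂ (summaryOf n S)
crosses₂-summaryOf n S = sym (foldr-fusion crosses₂ emptySummary (λ _ _ → refl) S)

coverCount-++ : ∀ S S′ c → coverCount (S ++ S′) c ≡ coverCount S c + coverCount S′ c
coverCount-++ S S′ c = sumOver-++ (λ p → indicator (covers p c)) S S′

coverCount-within : ∀ {S} → All WithinThreeColumns S → ∀ x y → coverCount S (3 + x , y) ≡ 0
coverCount-within []                         x y = refl
coverCount-within ((noCover , _) ∷ withinS) x y = cong₂ _+_ (cong indicator (noCover x y)) (coverCount-within withinS x y)

any-crosses-within : ∀ {S} → All WithinThreeColumns S → ∀ k → any (crosses (3 + k)) S ≡ false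
any-crosses-within []                          k = refl
any-crosses-within ((_ , noCross) ∷ withinS) k = cong₂ _∨_ (noCross k) (any-crosses-within withinS k)

next : State → Summary → State
next s a = state (zipWith _+_ (second s) (column a 1F)) (column a 2F) (crosses₂ a)

exactlyOnce : Column → Bool
exactlyOnce u = all (λ y → at u y ≡ᵇ 1) (upTo 4)

firstLineCrossed : ℕ → State → Summary → Bool
firstLineCrossed zero    s a = true
firstLineCrossed (suc n) s a = crossed s ∨ crosses₁ a

acceptable : ℕ → State → Summary → Bool
acceptable n s a = fits a ∧ (exactlyOnce (zipWith _+_ (first s) (column a 0F)) ∧ firstLineCrossed n s a)

columnCells : ℕ → List Cell
columnCells x = map (λ y → (x , y)) (upTo 4)

all-rectCells-suc : ∀ (R : Cell → Bool) n →
                    all R (rectCells (suc n)) ≡ all R (columnCells 0) ∧ all (all R ∘ columnCells ∘ suc) (upTo n)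
all-rectCells-suc R n = begin
  all R (rectCells (suc n))                                  ≡⟨ all-concatMap R columnCells (upTo (suc n)) ⟩
  all (all R ∘ columnCells) (upTo (suc n))                   ≡⟨ cong (all (all R ∘ columnCells)) (upTo-suc n) ⟩
  all R (columnCells 0) ∧ all (all R ∘ columnCells) (map suc (upTo n))
                                                             ≡⟨ cong (all R (columnCells 0) ∧_) (all-map suc _ (upTo n)) ⟩
  all R (columnCells 0) ∧ all (all R ∘ columnCells ∘ suc) (upTo n) ∎
  where open ≡-Reasoning

all-columnCells-cong : ∀ (R R′ : Cell → Bool) x x′ → (∀ {y} → y < 4 → R (x , y) ≡ R′ (x′ , y)) →
                       all R (columnCells x) ≡ all R′ (columnCells x′)
all-columnCells-cong R R′ x x′ R≗R′ = begin
  all R (columnCells x)               ≡⟨ all-map (λ y → (x , y)) R (upTo 4) ⟩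
  all (λ y → R (x , y)) (upTo 4)      ≡⟨ all-cong-∈ (R≗R′ ∘ ∈-upTo⁻) ⟩
  all (λ y → R′ (x′ , y)) (upTo 4)    ≡⟨ all-map (λ y → (x′ , y)) R′ (upTo 4) ⟨
  all R′ (columnCells x′)             ∎
  where open ≡-Reasoning

module _ (n : ℕ) (s : State) {S₀ : List Placement} (withinS₀ : All WithinThreeColumns S₀) (T : List Placement) where

  private
    a : Summary
    a = summaryOf n S₀

    S : List Placement
    S = S₀ ++ map shift T

  occupancy-next : ∀ x {y} → y < 4 → occupancy s (suc x , y) + coverCount S₀ (suc x , y) ≡ occupancy (next s a) (x , y)
  occupancy-next zero          {y} y<4 =
    trans (cong (at (second s) y +_) (coverCount-summaryOf n S₀ 1F y<4)) (sym (at-zipWith-+ (second s) _ y))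
  occupancy-next (suc zero)        y<4 = coverCount-summaryOf n S₀ 2F y<4
  occupancy-next (suc (suc x)) {y} _   = coverCount-within withinS₀ x y

  covered-column0 : ∀ {y} → y < 4 → ((occupancy s (0 , y) + coverCount S (0 , y)) ≡ᵇ 1)
                                  ≡ (at (zipWith _+_ (first s) (column a 0F)) y ≡ᵇ 1)
  covered-column0 {y} y<4 = cong (_≡ᵇ 1) (begin
    at (first s) y + coverCount S (0 , y)
      ≡⟨ cong (at (first s) y +_) (coverCount-++ S₀ (map shift T) (0 , y)) ⟩
    at (first s) y + (coverCount S₀ (0 , y) + coverCount (map shift T) (0 , y))
      ≡⟨ cong (λ m → at (first s) y + (coverCount S₀ (0 , y) + m)) (coverCount-shift-column0 T y) ⟩
    at (first s) y + (coverCount S₀ (0 , y) + 0)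
      ≡⟨ cong (at (first s) y +_) (trans (+-identityʳ _) (coverCount-summaryOf n S₀ 0F y<4)) ⟩
    at (first s) y + at (column a 0F) y
      ≡⟨ at-zipWith-+ (first s) (column a 0F) y ⟨
    at (zipWith _+_ (first s) (column a 0F)) y ∎)
    where open ≡-Reasoning

  covered-shift : ∀ x {y} → y < 4 → ((occupancy s (suc x , y) + coverCount S (suc x , y)) ≡ᵇ 1)
                                  ≡ ((occupancy (next s a) (x , y) + coverCount T (x , y)) ≡ᵇ 1)
  covered-shift x {y} y<4 = cong (_≡ᵇ 1) (begin
    occupancy s (suc x , y) + coverCount S (suc x , y)
      ≡⟨ cong (occupancy s (suc x , y) +_) (coverCount-++ S₀ (map shift T) (suc x , y)) ⟩
    occupancy s (suc x , y) + (coverCount S₀ (suc x , y) + coverCount (map shift T) (suc x , y))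
      ≡⟨ cong (λ m → occupancy s (suc x , y) + (coverCount S₀ (suc x , y) + m)) (coverCount-shift T (x , y)) ⟩
    occupancy s (suc x , y) + (coverCount S₀ (suc x , y) + coverCount T (x , y))
      ≡⟨ +-assoc (occupancy s (suc x , y)) _ _ ⟨
    occupancy s (suc x , y) + coverCount S₀ (suc x , y) + coverCount T (x , y)
      ≡⟨ cong (_+ coverCount T (x , y)) (occupancy-next x y<4) ⟩
    occupancy (next s a) (x , y) + coverCount T (x , y) ∎)
    where open ≡-Reasoning

  coverage-split : all (λ c → (occupancy s c + coverCount S c) ≡ᵇ 1) (rectCells (suc n))
                 ≡ exactlyOnce (zipWith _+_ (first s) (column a 0F))
                   ∧ all (λ c → (occupancy (next s a) c + coverCount T c) ≡ᵇ 1) (rectCells n)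
  coverage-split = trans (all-rectCells-suc covered n) (cong₂ _∧_
    (all-columnCells-cong covered (λ c → at (zipWith _+_ (first s) (column a 0F)) (proj₂ c) ≡ᵇ 1) 0 0 covered-column0)
    (trans (all-cong (λ x → all-columnCells-cong covered covered′ (suc x) x (covered-shift x)) (upTo n))
           (sym (all-concatMap covered′ columnCells (upTo n)))))
    where
    covered covered′ : Cell → Bool
    covered  c = (occupancy s c + coverCount S c) ≡ᵇ 1
    covered′ c = (occupancy (next s a) c + coverCount T c) ≡ᵇ 1

  inside-split : all (λ p → all (inRect (suc n)) (tileCells p)) S ≡ fits a ∧ all (λ p → all (inRect n) (tileCells p)) T
  inside-split = trans (all-++ _ S₀ (map shift T)) (cong₂ _∧_ (fits-summaryOf n S₀) (all-inside-shift n T))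

  line-crossed-shift : ∀ k → (crossed s ∧ (suc k ≡ᵇ 1)) ∨ any (crosses (suc k)) S
                           ≡ (crossed s ∧ (suc k ≡ᵇ 1)) ∨ (any (crosses (suc k)) S₀ ∨ any (crosses k) T)
  line-crossed-shift k = cong ((crossed s ∧ (suc k ≡ᵇ 1)) ∨_)
    (trans (any-++ (crosses (suc k)) S₀ (map shift T)) (cong (any (crosses (suc k)) S₀ ∨_) (any-crosses-shift k T)))

  first-line : (crossed s ∧ true) ∨ (any (crosses 1) S₀ ∨ any (crosses 0) T) ≡ crossed s ∨ crosses₁ a
  first-line = cong₂ _∨_ (∧-identityʳ (crossed s))
                         (trans (cong₂ _∨_ (crosses₁-summaryOf n S₀) (any-crosses-zero T)) (∨-identityʳ _))

  later-line : ∀ k → (crossed s ∧ false) ∨ (any (crosses (2 + k)) S₀ ∨ any (crosses (suc k)) T)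
                   ≡ (crossed (next s a) ∧ (suc k ≡ᵇ 1)) ∨ any (crosses (suc k)) T
  later-line k rewrite ∧-zeroʳ (crossed s) = lemma k
    where
    lemma : ∀ k → any (crosses (2 + k)) S₀ ∨ any (crosses (suc k)) T ≡ (crosses₂ a ∧ (suc k ≡ᵇ 1)) ∨ any (crosses (suc k)) T
    lemma zero    = cong₂ _∨_ (trans (crosses₂-summaryOf n S₀) (sym (∧-identityʳ _))) refl
    lemma (suc k) = cong₂ _∨_ (trans (any-crosses-within withinS₀ k) (sym (∧-zeroʳ _))) refl

  faults-split : all (λ k → (crossed s ∧ (k ≡ᵇ 1)) ∨ any (crosses k) S) (innerLines (suc n))
               ≡ firstLineCrossed n s a ∧ all (λ k → (crossed (next s a) ∧ (k ≡ᵇ 1)) ∨ any (crosses k) T) (innerLines n)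
  faults-split = begin
    all F (innerLines (suc n))  ≡⟨ cong (all F) (innerLines-suc n) ⟩
    all F (map suc (upTo n))    ≡⟨ all-map suc F (upTo n) ⟩
    all (F ∘ suc) (upTo n)      ≡⟨ all-cong line-crossed-shift (upTo n) ⟩
    all G (upTo n)              ≡⟨ lines n ⟩
    firstLineCrossed n s a ∧ all F′ (innerLines n) ∎
    where
    open ≡-Reasoning
    F G F′ : ℕ → Bool
    F  k = (crossed s ∧ (k ≡ᵇ 1)) ∨ any (crosses k) S
    G  k = (crossed s ∧ (suc k ≡ᵇ 1)) ∨ (any (crosses (suc k)) S₀ ∨ any (crosses k) T)
    F′ k = (crossed (next s a) ∧ (k ≡ᵇ 1)) ∨ any (crosses k) T
    lines : ∀ m → all G (upTo m) ≡ firstLineCrossed m s a ∧ all F′ (innerLines m)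
    lines zero    = refl
    lines (suc m) = begin
      all G (upTo (suc m))                               ≡⟨ cong (all G) (upTo-suc m) ⟩
      G 0 ∧ all G (map suc (upTo m))                     ≡⟨ cong₂ _∧_ first-line (all-map suc G (upTo m)) ⟩
      (crossed s ∨ crosses₁ a) ∧ all (G ∘ suc) (upTo m)    ≡⟨ cong (_ ∧_) (all-cong later-line (upTo m)) ⟩
      (crossed s ∨ crosses₁ a) ∧ all (F′ ∘ suc) (upTo m)   ≡⟨ cong (_ ∧_) (all-map suc F′ (upTo m)) ⟨
      (crossed s ∨ crosses₁ a) ∧ all F′ (map suc (upTo m)) ≡⟨ cong (λ ks → _ ∧ all F′ ks) (innerLines-suc m) ⟨
      firstLineCrossed (suc m) s a ∧ all F′ (innerLines (suc m)) ∎

  Completes-split : Completes (suc n) s S ≡ acceptable n s a ∧ Completes n (next s a) T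
  Completes-split = trans (cong₂ _∧_ (cong₂ _∧_ inside-split coverage-split) faults-split)
    (∧-reassociate (fits a) (all (λ p → all (inRect n) (tileCells p)) T)
                   (exactlyOnce (zipWith _+_ (first s) (column a 0F)))
                   (all (λ c → (occupancy (next s a) c + coverCount T c) ≡ᵇ 1) (rectCells n))
                   (firstLineCrossed n s a)
                   (all (λ k → (crossed (next s a) ∧ (k ≡ᵇ 1)) ∨ any (crosses k) T) (innerLines n)))

overfull : Column → Bool
overfull u = any (λ y → 2 ≤ᵇ at u y) (upTo 4)

2≤ᵇm⇒m+k≡ᵇ1≡false : ∀ m k → (2 ≤ᵇ m) ≡ true → ((m + k) ≡ᵇ 1) ≡ false
2≤ᵇm⇒m+k≡ᵇ1≡false (suc (suc m)) k _ = refl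

overfull-exactlyOnce : ∀ u w → overfull u ≡ true → exactlyOnce (zipWith _+_ u w) ≡ false
overfull-exactlyOnce u w over with y , y∈upTo4 , 2≤uy ← any-witness (λ y → 2 ≤ᵇ at u y) (upTo 4) over =
  all-∈-false (λ y → at (zipWith _+_ u w) y ≡ᵇ 1) y∈upTo4
              (trans (cong (_≡ᵇ 1) (at-zipWith-+ u w y)) (2≤ᵇm⇒m+k≡ᵇ1≡false (at u y) (at w y) 2≤uy))

doomed : State → Summary → Bool
doomed s a = not (fits a) ∨ overfull (zipWith _+_ (first s) (column a 0F))

first-column-⊕ : ∀ s a b → zipWith _+_ (first s) (column (a ⊕ b) 0F)
                          ≡ zipWith _+_ (zipWith _+_ (first s) (column a 0F)) (column b 0F)
first-column-⊕ s a b = begin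
  zipWith _+_ (first s) (column (a ⊕ b) 0F)
    ≡⟨ cong (zipWith _+_ (first s)) (lookup-zipWith (zipWith _+_) 0F (columns a) (columns b)) ⟩
  zipWith _+_ (first s) (zipWith _+_ (column a 0F) (column b 0F))
    ≡⟨ zipWith-assoc +-assoc (first s) (column a 0F) (column b 0F) ⟨
  zipWith _+_ (zipWith _+_ (first s) (column a 0F)) (column b 0F) ∎
  where open ≡-Reasoning

doomed-acceptable : ∀ n s a b → doomed s a ≡ true → acceptable n s (a ⊕ b) ≡ false
doomed-acceptable n s a b doom =
  trans (cong (λ u → (fits a ∧ fits b) ∧ (exactlyOnce u ∧ firstLineCrossed n s (a ⊕ b))) (first-column-⊕ s a b))
        (rejected (fits a) (fits b) _ _ _ doom (overfull-exactlyOnce (zipWith _+_ (first s) (column a 0F)) (column b 0F)))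
  where
  rejected : ∀ x y e l o → not x ∨ o ≡ true → (o ≡ true → e ≡ false) → (x ∧ y) ∧ (e ∧ l) ≡ false
  rejected false y e l o _    _         = refl
  rejected true  y e l o over overflows rewrite overflows over = ∧-zeroʳ y

-- The states left, with multiplicity, after choosing the first-column tiles of a rectangle of
-- width suc n: the tiles summarised by a together with a subset of ps.  Doomed branches are pruned.
successors : ℕ → State → Summary → List Placement → List State
successors n s a []       = if acceptable n s a then next s a ∷ [] else []
successors n s a (p ∷ ps) = if doomed s a then [] else (successors n s (a ⊕ summarize n p) ps ++ successors n s a ps)

contribution : ℕ → State → (State → ℕ) → Summary → ℕ
contribution n s f a = if acceptable n s a then f (next s a) else 0

successors-sound : ∀ n s (f : State → ℕ) a ps →
                   subsetSum (λ S → contribution n s f (a ⊕ summaryOf n S)) ps ≡ sumOver f (successors n s a ps)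
successors-sound n s f a [] = trans (+-identityʳ _) (trans (cong (contribution n s f) (⊕-identityʳ a)) leaf)
  where
  leaf : contribution n s f a ≡ sumOver f (if acceptable n s a then next s a ∷ [] else [])
  leaf with acceptable n s a
  ... | true  = sym (+-identityʳ _)
  ... | false = refl
successors-sound n s f a (p ∷ ps) with doomed s a in doom
... | true  = subsetSum-zero (λ S → cong (λ b → if b then f (next s (a ⊕ summaryOf n S)) else 0)
                                         (doomed-acceptable n s a (summaryOf n S) doom)) (p ∷ ps)
... | false = begin
  subsetSum (λ S → contribution n s f (a ⊕ summaryOf n S)) (p ∷ ps)
    ≡⟨ subsetSum-∷ _ p ps ⟩
  subsetSum (λ S → contribution n s f (a ⊕ (summarize n p ⊕ summaryOf n S))) ps
    + subsetSum (λ S → contribution n s f (a ⊕ summaryOf n S)) ps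
    ≡⟨ cong (_+ _) (subsetSum-cong (λ S → cong (contribution n s f) (⊕-assoc a (summarize n p) (summaryOf n S))) ps) ⟨
  subsetSum (λ S → contribution n s f ((a ⊕ summarize n p) ⊕ summaryOf n S)) ps
    + subsetSum (λ S → contribution n s f (a ⊕ summaryOf n S)) ps
    ≡⟨ cong₂ _+_ (successors-sound n s f (a ⊕ summarize n p) ps) (successors-sound n s f a ps) ⟩
  sumOver f (successors n s (a ⊕ summarize n p) ps) + sumOver f (successors n s a ps)
    ≡⟨ sumOver-++ f (successors n s (a ⊕ summarize n p) ps) (successors n s a ps) ⟨
  sumOver f (successors n s (a ⊕ summarize n p) ps ++ successors n s a ps) ∎
  where open ≡-Reasoning

opaque
  unfolding completions

  completions-suc : ∀ n s L → placements (suc n) ↭ L ++ map shift (placements n) → All WithinThreeColumns L →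
                    completions (suc n) s ≡ sumOver (completions n) (successors n s emptySummary L)
  completions-suc n s L placements↭ withinL = begin
    completions (suc n) s
      ≡⟨ subsetSum-↭ χ (cong indicator ∘ Completes-↭ (suc n) s) placements↭ ⟩
    subsetSum χ (L ++ map shift (placements n))
      ≡⟨ subsetSum-++ χ L (map shift (placements n)) ⟩
    subsetSum (λ S₀ → subsetSum (χ ∘ (S₀ ++_)) (map shift (placements n))) L
      ≡⟨ subsetSum-cong (λ S₀ → subsetSum-map (χ ∘ (S₀ ++_)) shift (placements n)) L ⟩
    subsetSum (λ S₀ → subsetSum (λ T → χ (S₀ ++ map shift T)) (placements n)) L
      ≡⟨ subsetSum-cong-All withinL split ⟩
    subsetSum (λ S₀ → contribution n s (completions n) (emptySummary ⊕ summaryOf n S₀)) L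
      ≡⟨ successors-sound n s (completions n) emptySummary L ⟩
    sumOver (completions n) (successors n s emptySummary L) ∎
    where
    open ≡-Reasoning
    χ : List Placement → ℕ
    χ = indicator ∘ Completes (suc n) s
    gate : ∀ b s′ → subsetSum (λ T → indicator (b ∧ Completes n s′ T)) (placements n)
                    ≡ (if b then completions n s′ else 0)
    gate true  s′ = refl
    gate false s′ = subsetSum-zero (λ _ → refl) (placements n)
    split : ∀ S₀ → All WithinThreeColumns S₀ →
            subsetSum (λ T → χ (S₀ ++ map shift T)) (placements n)
            ≡ contribution n s (completions n) (emptySummary ⊕ summaryOf n S₀)
    split S₀ withinS₀ = begin
      subsetSum (λ T → χ (S₀ ++ map shift T)) (placements n)
        ≡⟨ subsetSum-cong (λ T → cong indicator (Completes-split n s withinS₀ T)) (placements n) ⟩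
      subsetSum (λ T → indicator (acceptable n s a ∧ Completes n (next s a) T)) (placements n)
        ≡⟨ gate (acceptable n s a) (next s a) ⟩
      contribution n s (completions n) a
        ≡⟨ cong (contribution n s (completions n)) (⊕-identityˡ a) ⟨
      contribution n s (completions n) (emptySummary ⊕ a) ∎
      where
      a : Summary
      a = summaryOf n S₀

-- The transfer matrix

∈-rectCells : ∀ {n x y} → x < n → y < 4 → (x , y) ∈ rectCells n
∈-rectCells {x = x} x<n y<4 = ∈-concat⁺′ (∈-map⁺ (λ y → (x , y)) (∈-upTo⁺ y<4)) (∈-map⁺ columnCells (∈-upTo⁺ x<n))

opaque
  unfolding completions

  overcovered-completions : ∀ n s {x y} → x < n → y < 4 → (2 ≤ᵇ occupancy s (x , y)) ≡ true → completions n s ≡ 0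
  overcovered-completions n s {x} {y} x<n y<4 twice = subsetSum-zero (λ S → cong indicator (rejected S)) (placements n)
    where
    rejected : ∀ S → Completes n s S ≡ false
    rejected S = trans (cong (λ c → (inside ∧ c) ∧ faultFree) uncovered) (cong (_∧ faultFree) (∧-zeroʳ inside))
      where
      inside faultFree : Bool
      inside    = all (λ p → all (inRect n) (tileCells p)) S
      faultFree = all (λ k → (crossed s ∧ (k ≡ᵇ 1)) ∨ any (crosses k) S) (innerLines n)
      uncovered : all (λ c → (occupancy s c + coverCount S c) ≡ᵇ 1) (rectCells n) ≡ false
      uncovered = all-∈-false (λ c → (occupancy s c + coverCount S c) ≡ᵇ 1) (∈-rectCells x<n y<4)
                              (2≤ᵇm⇒m+k≡ᵇ1≡false (occupancy s (x , y)) (coverCount S (x , y)) twice)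

overfull-completions : ∀ n s x (u : Column) → x < n → (∀ y → occupancy s (x , y) ≡ at u y) →
                       overfull u ≡ true → completions n s ≡ 0
overfull-completions n s x u x<n occupancy≡ over
  with y , y∈upTo4 , twice ← any-witness (λ y → 2 ≤ᵇ at u y) (upTo 4) over =
  overcovered-completions n s x<n (∈-upTo⁻ y∈upTo4) (trans (cong (2 ≤ᵇ_) (occupancy≡ y)) twice)

hopeless : ℕ → State → Bool
hopeless zero          s = false
hopeless (suc zero)    s = overfull (first s)
hopeless (suc (suc n)) s = overfull (first s) ∨ overfull (second s)

hopeless-completions : ∀ n s → hopeless n s ≡ true → completions n s ≡ 0
hopeless-completions (suc zero)    s over = overfull-completions _ s 0 (first s) (s≤s z≤n) (λ _ → refl) over
hopeless-completions (suc (suc n)) s over with overfull (first s) in over₀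
... | true  = overfull-completions _ s 0 (first s) (s≤s z≤n) (λ _ → refl) over₀
... | false = overfull-completions _ s 1 (second s) (s≤s (s≤s z≤n)) (λ _ → refl) over

_≟ˢ_ : DecidableEquality State
state u v c ≟ˢ state u′ v′ c′ =
  map′ (λ { (refl , refl , refl) → refl }) (λ { refl → refl , refl , refl })
       (Vec.≡-dec ℕ._≟_ u u′ ×-dec Vec.≡-dec ℕ._≟_ v v′ ×-dec c Bool.≟ c′)

module _ {k : ℕ} (table : Vec State k) where

  locate : (s : State) → Dec (∃[ i ] lookup table i ≡ s)
  locate s = any? (λ i → lookup table i ≟ˢ s)

  indicesIn : List State → List (Fin k)
  indicesIn []      = []
  indicesIn (s ∷ l) with locate s
  ... | yes (i , _) = i ∷ indicesIn l
  ... | no _        = indicesIn l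

  sumOver-indicesIn : (bad : State → Bool) (f : State → ℕ) → (∀ s → bad s ≡ true → f s ≡ 0) →
                      ∀ l → all (λ s → does (locate s) ∨ bad s) l ≡ true →
                      sumOver f l ≡ sumOver (f ∘ lookup table) (indicesIn l)
  sumOver-indicesIn bad f bad⇒0 []      _     = refl
  sumOver-indicesIn bad f bad⇒0 (s ∷ l) known with locate s
  ... | yes (i , refl) = cong (f (lookup table i) +_) (sumOver-indicesIn bad f bad⇒0 l known)
  ... | no _           =
    cong₂ _+_ (bad⇒0 s (∧-conicalˡ _ _ known)) (sumOver-indicesIn bad f bad⇒0 l (∧-conicalʳ _ _ known))

-- The states reachable from the empty state, which comes first.
states : Vec State 23
states =
  state (0 ∷ 0 ∷ 0 ∷ 0 ∷ []) (0 ∷ 0 ∷ 0 ∷ 0 ∷ []) false ∷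
  state (1 ∷ 1 ∷ 1 ∷ 1 ∷ []) (0 ∷ 0 ∷ 0 ∷ 0 ∷ []) false ∷
  state (1 ∷ 0 ∷ 0 ∷ 1 ∷ []) (0 ∷ 0 ∷ 1 ∷ 1 ∷ []) true ∷
  state (1 ∷ 1 ∷ 0 ∷ 0 ∷ []) (1 ∷ 1 ∷ 0 ∷ 0 ∷ []) true ∷
  state (0 ∷ 0 ∷ 1 ∷ 1 ∷ []) (0 ∷ 0 ∷ 1 ∷ 1 ∷ []) true ∷
  state (1 ∷ 0 ∷ 0 ∷ 1 ∷ []) (1 ∷ 1 ∷ 0 ∷ 0 ∷ []) true ∷
  state (1 ∷ 0 ∷ 1 ∷ 0 ∷ []) (1 ∷ 0 ∷ 1 ∷ 0 ∷ []) true ∷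
  state (1 ∷ 0 ∷ 0 ∷ 1 ∷ []) (1 ∷ 0 ∷ 0 ∷ 1 ∷ []) true ∷
  state (0 ∷ 1 ∷ 1 ∷ 0 ∷ []) (0 ∷ 1 ∷ 1 ∷ 0 ∷ []) true ∷
  state (0 ∷ 1 ∷ 0 ∷ 1 ∷ []) (0 ∷ 1 ∷ 0 ∷ 1 ∷ []) true ∷
  state (0 ∷ 1 ∷ 1 ∷ 1 ∷ []) (0 ∷ 1 ∷ 0 ∷ 0 ∷ []) true ∷
  state (1 ∷ 1 ∷ 1 ∷ 0 ∷ []) (0 ∷ 0 ∷ 1 ∷ 0 ∷ []) true ∷
  state (1 ∷ 1 ∷ 0 ∷ 1 ∷ []) (0 ∷ 0 ∷ 0 ∷ 1 ∷ []) true ∷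
  state (1 ∷ 0 ∷ 1 ∷ 1 ∷ []) (1 ∷ 0 ∷ 0 ∷ 0 ∷ []) true ∷
  state (1 ∷ 1 ∷ 1 ∷ 1 ∷ []) (1 ∷ 1 ∷ 1 ∷ 1 ∷ []) true ∷
  state (1 ∷ 1 ∷ 0 ∷ 1 ∷ []) (0 ∷ 1 ∷ 0 ∷ 0 ∷ []) true ∷
  state (1 ∷ 0 ∷ 1 ∷ 1 ∷ []) (0 ∷ 0 ∷ 1 ∷ 0 ∷ []) true ∷
  state (0 ∷ 0 ∷ 1 ∷ 1 ∷ []) (0 ∷ 1 ∷ 1 ∷ 0 ∷ []) true ∷
  state (1 ∷ 1 ∷ 0 ∷ 0 ∷ []) (0 ∷ 1 ∷ 1 ∷ 0 ∷ []) true ∷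
  state (0 ∷ 1 ∷ 1 ∷ 0 ∷ []) (0 ∷ 0 ∷ 1 ∷ 1 ∷ []) true ∷
  state (0 ∷ 1 ∷ 1 ∷ 0 ∷ []) (1 ∷ 1 ∷ 0 ∷ 0 ∷ []) true ∷
  state (1 ∷ 1 ∷ 1 ∷ 0 ∷ []) (1 ∷ 0 ∷ 0 ∷ 0 ∷ []) true ∷
  state (0 ∷ 1 ∷ 1 ∷ 1 ∷ []) (0 ∷ 0 ∷ 0 ∷ 1 ∷ []) true ∷
  []

-- Row j lists, with multiplicity, the indices of the successors of states j when no, one, or at
-- least two further columns remain.
lastColumnTransitions penultimateColumnTransitions innerColumnTransitions : Vec (List (Fin 23)) 23
lastColumnTransitions =
  [] ∷ (# 0 ∷ []) ∷ [] ∷ [] ∷ [] ∷ [] ∷ [] ∷ [] ∷ [] ∷ [] ∷ [] ∷ [] ∷ [] ∷ [] ∷ (# 1 ∷ []) ∷ [] ∷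
  [] ∷ [] ∷ [] ∷ [] ∷ [] ∷ [] ∷ [] ∷ []

penultimateColumnTransitions =
  (# 1 ∷ # 1 ∷ []) ∷ [] ∷ [] ∷ [] ∷ [] ∷ [] ∷ [] ∷ [] ∷ [] ∷ [] ∷ [] ∷ [] ∷ (# 1 ∷ []) ∷
  (# 1 ∷ []) ∷ (# 1 ∷ []) ∷ [] ∷ [] ∷ [] ∷ [] ∷ [] ∷ [] ∷ (# 1 ∷ []) ∷ (# 1 ∷ []) ∷ []

innerColumnTransitions =
  (# 1 ∷ # 2 ∷ # 3 ∷ # 1 ∷ # 4 ∷ # 5 ∷ # 6 ∷ # 7 ∷ # 8 ∷ # 9 ∷ []) ∷ [] ∷ (# 10 ∷ []) ∷
  (# 11 ∷ # 12 ∷ []) ∷ (# 13 ∷ # 10 ∷ []) ∷ (# 11 ∷ []) ∷ (# 14 ∷ []) ∷ (# 15 ∷ # 14 ∷ # 16 ∷ []) ∷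
  (# 14 ∷ []) ∷ (# 14 ∷ []) ∷ (# 3 ∷ []) ∷ (# 4 ∷ []) ∷ (# 1 ∷ # 4 ∷ # 17 ∷ []) ∷
  (# 1 ∷ # 18 ∷ # 3 ∷ []) ∷ (# 1 ∷ []) ∷ (# 19 ∷ # 8 ∷ []) ∷ (# 8 ∷ # 20 ∷ []) ∷ (# 21 ∷ []) ∷
  (# 22 ∷ []) ∷ [] ∷ [] ∷ (# 1 ∷ # 2 ∷ []) ∷ (# 1 ∷ # 5 ∷ []) ∷ []

transitionTable : ℕ → Vec (List (Fin 23)) 23
transitionTable zero          = lastColumnTransitions
transitionTable (suc zero)    = penultimateColumnTransitions
transitionTable (suc (suc _)) = innerColumnTransitions

successorStates : ℕ → Fin 23 → List State
successorStates n j = successors n (lookup states j) emptySummary firstColumnPlacements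

TransitionsAgree : ℕ → Fin 23 → Set
TransitionsAgree n j = all (λ s → does (locate states s) ∨ hopeless n s) (successorStates n j) ≡ true
                       × indicesIn states (successorStates n j) ≡ lookup (transitionTable n) j

transitionsAgree? : ∀ n j → Dec (TransitionsAgree n j)
transitionsAgree? n j =
  all (λ s → does (locate states s) ∨ hopeless n s) (successorStates n j) Bool.≟ true
  ×-dec List.≡-dec Fin._≟_ (indicesIn states (successorStates n j)) (lookup (transitionTable n) j)

-- Checked by evaluation.  With at least two further columns the check is uniform in the width,
-- since tiles anchored in the first column reach only three columns.
transitionsAgree : ∀ n j → TransitionsAgree n j
transitionsAgree zero          = toWitness {a? = all? (transitionsAgree? 0)} _
transitionsAgree (suc zero)    = toWitness {a? = all? (transitionsAgree? 1)} _
transitionsAgree (suc (suc m)) = toWitness {a? = all? (transitionsAgree? (suc (suc m)))} _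

-- Opaque, so that conversion checking never unfolds these nested vectors.
opaque
  countVector : ℕ → Vec ℕ 23
  countVector zero    = replicate 23 1
  countVector (suc n) = tabulate λ j → sumOver (lookup (countVector n)) (lookup (transitionTable n) j)

  lookup-countVector-zero : ∀ j → lookup (countVector 0) j ≡ 1
  lookup-countVector-zero j = lookup-replicate j 1

  lookup-countVector-suc : ∀ n j → lookup (countVector (suc n)) j
                                  ≡ sumOver (lookup (countVector n)) (lookup (transitionTable n) j)
  lookup-countVector-suc n j = lookup∘tabulate (λ j → sumOver (lookup (countVector n)) (lookup (transitionTable n) j)) j

  countVector-13 : countVector 13 ≡ zipWith (λ a b → 2 * a + b) (countVector 11) (countVector 7)
  countVector-13 = refl

completions-states : ∀ n j → completions n (lookup states j) ≡ lookup (countVector n) j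
completions-states zero    j = trans (completions-zero (lookup states j)) (sym (lookup-countVector-zero j))
completions-states (suc n) j = begin
  completions (suc n) (lookup states j)
    ≡⟨ completions-suc n (lookup states j) firstColumnPlacements (placements-suc-↭ n) firstColumnPlacements-within ⟩
  sumOver (completions n) (successorStates n j)
    ≡⟨ sumOver-indicesIn states (hopeless n) (completions n) (hopeless-completions n)
                         (successorStates n j) (proj₁ (transitionsAgree n j)) ⟩
  sumOver (completions n ∘ lookup states) (indicesIn states (successorStates n j))
    ≡⟨ cong (sumOver (completions n ∘ lookup states)) (proj₂ (transitionsAgree n j)) ⟩
  sumOver (completions n ∘ lookup states) (lookup (transitionTable n) j)
    ≡⟨ sumOver-cong (completions-states n) (lookup (transitionTable n) j) ⟩
  sumOver (lookup (countVector n)) (lookup (transitionTable n) j)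
    ≡⟨ lookup-countVector-suc n j ⟨
  lookup (countVector (suc n)) j ∎
  where open ≡-Reasoning

N'-countVector : ∀ t → N' (suc t) ≡ lookup (countVector (2 * suc t)) 0F
N'-countVector t = trans (numFaultFree-completions (2 * suc t)) (completions-states (2 * suc t) 0F)

-- The base case is a computation; a transition step is linear, so it propagates the recurrence.
countVector-recurrence : ∀ m j → lookup (countVector (13 + m)) j
                               ≡ 2 * lookup (countVector (11 + m)) j + lookup (countVector (7 + m)) j
countVector-recurrence zero    j =
  trans (cong (λ v → lookup v j) countVector-13) (lookup-zipWith (λ a b → 2 * a + b) j (countVector 11) (countVector 7))
countVector-recurrence (suc m) j = begin
  lookup (countVector (14 + m)) j
    ≡⟨ lookup-countVector-suc (13 + m) j ⟩
  sumOver (lookup (countVector (13 + m))) (lookup innerColumnTransitions j)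
    ≡⟨ sumOver-cong (countVector-recurrence m) (lookup innerColumnTransitions j) ⟩
  sumOver (λ i → 2 * lookup (countVector (11 + m)) i + lookup (countVector (7 + m)) i) (lookup innerColumnTransitions j)
    ≡⟨ sumOver-linear 2 (lookup (countVector (11 + m))) (lookup (countVector (7 + m))) (lookup innerColumnTransitions j) ⟩
  2 * sumOver (lookup (countVector (11 + m))) (lookup innerColumnTransitions j)
    + sumOver (lookup (countVector (7 + m))) (lookup innerColumnTransitions j)
    ≡⟨ cong₂ (λ u v → 2 * u + v) (lookup-countVector-suc (11 + m) j) (lookup-countVector-suc (7 + m) j) ⟨
  2 * lookup (countVector (12 + m)) j + lookup (countVector (8 + m)) j ∎
  where open ≡-Reasoning

N'-recurrence : ∀ m → N' (7 + m) ≡ 2 * N' (6 + m) + N' (4 + m)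
N'-recurrence m = begin
  N' (7 + m)                                                     ≡⟨ N'-countVector (6 + m) ⟩
  lookup (countVector (2 * (7 + m))) 0F                    ≡⟨ cong (λ k → lookup (countVector k) 0F) (*-distribˡ-+ 2 7 m) ⟩
  lookup (countVector (13 + suc (2 * m))) 0F               ≡⟨ countVector-recurrence (suc (2 * m)) 0F ⟩
  2 * lookup (countVector (11 + suc (2 * m))) 0F + lookup (countVector (7 + suc (2 * m))) 0F
    ≡⟨ cong₂ (λ u v → 2 * lookup (countVector u) 0F + lookup (countVector v) 0F)
             (*-distribˡ-+ 2 6 m) (*-distribˡ-+ 2 4 m) ⟨
  2 * lookup (countVector (2 * (6 + m))) 0F + lookup (countVector (2 * (4 + m))) 0F
    ≡⟨ cong₂ (λ u v → 2 * u + v) (N'-countVector (5 + m)) (N'-countVector (3 + m)) ⟨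
  2 * N' (6 + m) + N' (4 + m)                                    ∎
  where open ≡-Reasoning

-- The generating function

module _ where

  open import Data.Integer as ℤ using (ℤ; +_; -[1+_])
  open import Data.Integer.Properties using (pos-+; pos-*; +-inverseʳ)
  open import Data.Integer.Solver using (module +-*-Solver)

  ⋆-cong-≤ : (f g h : Series) (t : ℕ) → (∀ i → i ≤ t → g i ≡ h i) → (f ⋆ g) t ≡ (f ⋆ h) t
  ⋆-cong-≤ f g h t g≗h =
    foldr-cong (λ i s → cong (λ u → f i ℤ.* u ℤ.+ s) (g≗h (t ∸ i) (m∸n≤m t i))) refl (upTo (suc t))

  vanishing-terms : (c g : ℕ → ℤ) (f : ℕ → ℕ) → (∀ i → c (f i) ≡ + 0) →
                    ∀ m → foldr (λ i s → c i ℤ.* g i ℤ.+ s) (+ 0) (applyUpTo f m) ≡ + 0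
  vanishing-terms c g f c≡0 zero    = refl
  vanishing-terms c g f c≡0 (suc m) =
    cong₂ (λ x r → x ℤ.* g (f 0) ℤ.+ r) (c≡0 0) (vanishing-terms c g (f ∘ suc) (c≡0 ∘ suc) m)

  denominator-⋆ : (g : Series) (m : ℕ) → (coeff denominator ⋆ g) (3 + m) ≡ g (3 + m) ℤ.- (+ 2 ℤ.* g (2 + m) ℤ.+ g m)
  denominator-⋆ g m = begin
    (coeff denominator ⋆ g) (3 + m)
      ≡⟨ cong (leading (g (3 + m)) (g (2 + m)) (g (1 + m)) (g m))
              (vanishing-terms (coeff denominator) (λ i → g ((3 + m) ∸ i)) (λ i → 4 + i) (λ _ → refl) m) ⟩
    leading (g (3 + m)) (g (2 + m)) (g (1 + m)) (g m) (+ 0)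
      ≡⟨ simplify (g (3 + m)) (g (2 + m)) (g (1 + m)) (g m) ⟩
    g (3 + m) ℤ.- (+ 2 ℤ.* g (2 + m) ℤ.+ g m) ∎
    where
    open ≡-Reasoning
    open +-*-Solver
    leading : ℤ → ℤ → ℤ → ℤ → ℤ → ℤ
    leading a b c d r = + 1 ℤ.* a ℤ.+ (-[1+ 1 ] ℤ.* b ℤ.+ (+ 0 ℤ.* c ℤ.+ (-[1+ 0 ] ℤ.* d ℤ.+ r)))
    simplify : ∀ a b c d → leading a b c d (+ 0) ≡ a ℤ.- (+ 2 ℤ.* b ℤ.+ d)
    simplify = solve 4 (λ a b c d →
      con (+ 1) :* a :+ (con -[1+ 1 ] :* b :+ (con (+ 0) :* c :+ (con -[1+ 0 ] :* d :+ con (+ 0))))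
        := a :- (con (+ 2) :* b :+ d)) refl

  genN'-recurrence : ∀ m → genN' (7 + m) ≡ + 2 ℤ.* genN' (6 + m) ℤ.+ genN' (4 + m)
  genN'-recurrence m = begin
    + N' (7 + m)                              ≡⟨ cong +_ (N'-recurrence m) ⟩
    + (2 * N' (6 + m) + N' (4 + m))           ≡⟨ pos-+ (2 * N' (6 + m)) (N' (4 + m)) ⟩
    + (2 * N' (6 + m)) ℤ.+ + N' (4 + m)       ≡⟨ cong (ℤ._+ + N' (4 + m)) (pos-* 2 (N' (6 + m))) ⟩
    + 2 ℤ.* + N' (6 + m) ℤ.+ + N' (4 + m)     ∎
    where open ≡-Reasoning

  initialValues : Poly
  initialValues = + 0 ∷ + 2 ∷ + 6 ∷ + 10 ∷ + 18 ∷ + 38 ∷ + 84 ∷ []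

  opaque
    unfolding countVector

    genN'-initial : ∀ t → t ≤ 6 → genN' t ≡ coeff initialValues t
    genN'-initial zero    _         = refl
    genN'-initial (suc t) (s≤s t≤5) = trans (cong +_ (N'-countVector t)) (value t t≤5)
      where
      value : ∀ t → t ≤ 5 → + lookup (countVector (2 * suc t)) 0F ≡ coeff initialValues (suc t)
      value 0 _ = refl
      value 1 _ = refl
      value 2 _ = refl
      value 3 _ = refl
      value 4 _ = refl
      value 5 _ = refl
      value (suc (suc (suc (suc (suc (suc _)))))) (s≤s (s≤s (s≤s (s≤s (s≤s ())))))

  highCoefficients : ∀ m → (coeff denominator ⋆ genN') (7 + m) ≡ coeff numerator (7 + m)
  highCoefficients m = begin
    (coeff denominator ⋆ genN') (7 + m)  ≡⟨ denominator-⋆ genN' (4 + m) ⟩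
    genN' (7 + m) ℤ.- recurrent          ≡⟨ cong (ℤ._- recurrent) (genN'-recurrence m) ⟩
    recurrent ℤ.- recurrent              ≡⟨ +-inverseʳ recurrent ⟩
    + 0                                  ∎
    where
    open ≡-Reasoning
    recurrent : ℤ
    recurrent = + 2 ℤ.* genN' (6 + m) ℤ.+ genN' (4 + m)

  lowCoefficients : ∀ t → t ≤ 6 → (coeff denominator ⋆ genN') t ≡ coeff numerator t
  lowCoefficients t t≤6 =
    trans (⋆-cong-≤ (coeff denominator) genN' (coeff initialValues) t (λ i i≤t → genN'-initial i (≤-trans i≤t t≤6)))
          (agrees t t≤6)
    where
    agrees : ∀ t → t ≤ 6 → (coeff denominator ⋆ coeff initialValues) t ≡ coeff numerator t
    agrees 0 _ = refl
    agrees 1 _ = refl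
    agrees 2 _ = refl
    agrees 3 _ = refl
    agrees 4 _ = refl
    agrees 5 _ = refl
    agrees 6 _ = refl
    agrees (suc (suc (suc (suc (suc (suc (suc _))))))) (s≤s (s≤s (s≤s (s≤s (s≤s (s≤s ()))))))

mainTheorem6 : ∀ t → (coeff denominator ⋆ genN') t ≡ coeff numerator t
mainTheorem6 t with t ≤? 6
... | yes t≤6 = lowCoefficients t t≤6
... | no  t≰6 with m , refl ← m≤n⇒∃[o]m+o≡n (≰⇒> t≰6) = highCoefficients m
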